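{- For all nonnegative integers $n$ and $k$, $$\sum_{j=-k}^{k} (-1)^j q^{\frac{j(3j-1)}{2}} \begin{bmatrix} n \\ k-j \end{bmatrix} \begin{bmatrix} n \\ k+j \end{bmatrix} = \sum_{j\in\mathbb{Z}} (-1)^j q^{\frac{j(3j-1)}{2}} \begin{bmatrix} n \\ k-j \end{bmatrix} \begin{bmatrix} n+1 \\ k+j \end{bmatrix} = \sum_{j\in\mathbb{Z}} (-1)^j q^{\frac{j(3j+1)}{2}} \begin{bmatrix} n \\ k-j \end{bmatrix} \begin{bmatrix} n+1 \\ k+j+1 \end{bmatrix} = \begin{bmatrix} n \\ k \end{bmatrix}.$$
   Context: $q$ is an indeterminate. For integers $m$ and $k$, the $q$-binomial coefficient is $\begin{bmatrix} m \\ k \end{bmatrix} = \prod_{i=1}^{k}\frac{1-q^{m-k+i}}{1-q^{i}}$ if $0\le k\le m$, and $\begin{bmatrix} m \\ k \end{bmatrix}=0$ otherwise. Sums over $j\in\mathbb{Z}$ have only finitely many nonzero terms. -}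

module Defs where

open import Algebra.Bundles using (CommutativeRing)
open import Data.Nat as ℕ using (ℕ; zero; suc)
open import Data.Integer as ℤ using (ℤ; +_; -[1+_]; ∣_∣)

-- All q-series here are polynomials in q with integer coefficients.  We
-- interpret them in an arbitrary commutative ring R at an arbitrary element q;
-- an identity holding for every (R, q) is exactly an identity in ℤ[q]
-- (take R = ℤ[q] and q the indeterminate; conversely evaluate).
module QSeries {c ℓ} (R : CommutativeRing c ℓ) where
  open CommutativeRing R

  pow : Carrier → ℕ → Carrier
  pow x zero    = 1#
  pow x (suc e) = x * pow x e

  negOnePowℕ : ℕ → Carrier
  negOnePowℕ zero    = 1#
  negOnePowℕ (suc e) = - 1# * negOnePowℕ e

  signPow : ℤ → Carrier
  signPow j = negOnePowℕ ∣ j ∣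

  -- q-binomial [m k] for natural m, k, via the q-Pascal rule
  -- [m+1, k+1] = [m, k] + q^(k+1) [m, k+1],  [m,0] = 1,  [0,k+1] = 0,
  -- which is the polynomial ∏_{i=1}^k (1-q^(m-k+i))/(1-q^i) (0 if k > m).
  qbinℕ : Carrier → ℕ → ℕ → Carrier
  qbinℕ q m       zero    = 1#
  qbinℕ q zero    (suc k) = 0#
  qbinℕ q (suc m) (suc k) = qbinℕ q m k + pow q (suc k) * qbinℕ q m (suc k)

  -- q-binomial for integer arguments: zero unless 0 ≤ k ≤ m
  qbin : Carrier → ℤ → ℤ → Carrier
  qbin q (+ m)     (+ k)     = qbinℕ q m k
  qbin q (+ m)     -[1+ _ ]  = 0#
  qbin q -[1+ _ ]  _         = 0#

  sumRange : ℤ → ℕ → (ℤ → Carrier) → Carrier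
  sumRange lo zero      f = 0#
  sumRange lo (suc len) f = f lo + sumRange (lo ℤ.+ ℤ.1ℤ) len f

-- j(3j-1)/2 and j(3j+1)/2 as natural numbers (both are nonnegative integers)
pentMinus : ℤ → ℕ
pentMinus j = ∣ j ℤ.* ((+ 3) ℤ.* j ℤ.- ℤ.1ℤ) ∣ ℕ./ 2

pentPlus : ℤ → ℕ
pentPlus j = ∣ j ℤ.* ((+ 3) ℤ.* j ℤ.+ ℤ.1ℤ) ∣ ℕ./ 2

-- Call the three sums A(n,k), B(n,k) and C(n,k). Group the terms of B into the pairs of indices
-- {-m, m+1} and those of C into the pairs {m, -m-1}, and expand one q-binomial of each term by a
-- q-Pascal rule. The two cross terms of a pair carry opposite signs and the same power of q (the
-- exponents match because ω(m) = m(3m-1)/2 satisfies ω(m+1) = ω(m) + 3m + 1), so each pair reduces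
-- to the pair {-m, m+1} of A; hence B = C = A. Expanding the factor [n+1, k+1+j] of the j-th term
-- of A(n+1,k+1) in the same way gives A(n+1,k+1) = C(n,k) + q^(k+1) B(n,k+1), which is the q-Pascal
-- recurrence of [n,k]; the boundary values agree too, so A(n,k) = [n,k].

module Submission where

open import Defs
open import Algebra.Bundles using (CommutativeRing)
open import Data.Nat using (ℕ; suc)
open import Data.Integer as ℤ using (ℤ; +_)
open import Data.Product using (_×_; _,_)

open import Data.Integer using (-[1+_]; ∣_∣)
open import Data.Integer.Properties as ZP using (abs-*; ∣⊖∣-≤)
open import Data.Nat as ℕ using (zero; _∸_; _≤_; _<_; s≤s)
open import Data.Nat.Properties as ℕ using (m+[n∸m]≡n)
open import Data.Nat.DivMod using (m*n/n≡m)
open import Data.Nat.Tactic.RingSolver using (solve-∀)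
open import Relation.Binary.PropositionalEquality as ≡ using (_≡_)
open import Relation.Nullary using (yes; no)

module PentagonalNumbers where
  open Data.Nat using (_+_; _*_; _/_)
  open ≡ using (refl; cong; sym; trans)

  pentMinusℕ : ℕ → ℕ
  pentMinusℕ zero    = 0
  pentMinusℕ (suc m) = pentMinusℕ m + (3 * m + 1)

  pentPlusℕ : ℕ → ℕ
  pentPlusℕ m = pentMinusℕ m + m

  pentMinusℕ-suc*2 : ∀ m → pentMinusℕ (suc m) * 2 ≡ suc m * (3 * m + 2)
  pentMinusℕ-suc*2 zero    = refl
  pentMinusℕ-suc*2 (suc m) = begin
    pentMinusℕ (suc (suc m)) * 2
      ≡⟨ ℕ.*-distribʳ-+ 2 (pentMinusℕ (suc m)) _ ⟩
    pentMinusℕ (suc m) * 2 + (3 * suc m + 1) * 2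
      ≡⟨ cong (_+ (3 * suc m + 1) * 2) (pentMinusℕ-suc*2 m) ⟩
    suc m * (3 * m + 2) + (3 * suc m + 1) * 2
      ≡⟨ step m ⟩
    suc (suc m) * (3 * suc m + 2) ∎
    where
    open ≡.≡-Reasoning
    step : ∀ m → suc m * (3 * m + 2) + (3 * suc m + 1) * 2
               ≡ suc (suc m) * (3 * suc m + 2)
    step = solve-∀

  pentPlusℕ-suc*2 : ∀ m → pentPlusℕ (suc m) * 2 ≡ suc m * (3 * m + 4)
  pentPlusℕ-suc*2 m = begin
    pentPlusℕ (suc m) * 2                  ≡⟨ ℕ.*-distribʳ-+ 2 (pentMinusℕ (suc m)) (suc m) ⟩
    pentMinusℕ (suc m) * 2 + suc m * 2     ≡⟨ cong (_+ suc m * 2) (pentMinusℕ-suc*2 m) ⟩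
    suc m * (3 * m + 2) + suc m * 2        ≡⟨ ℕ.*-distribˡ-+ (suc m) _ 2 ⟨
    suc m * (3 * m + 2 + 2)                ≡⟨ cong (suc m *_) (ℕ.+-assoc (3 * m) 2 2) ⟩
    suc m * (3 * m + 4)                    ∎
    where open ≡.≡-Reasoning

  halve : ∀ {a} b → a ≡ b * 2 → a / 2 ≡ b
  halve b refl = m*n/n≡m b 2

  m+2[1+m]≡3m+2 : ∀ m → m + 2 * suc m ≡ 3 * m + 2
  m+2[1+m]≡3m+2 = solve-∀

  -- For j = + suc m and j = -[1+ m ], Agda normalises ∣ 3j ∓ 1 ∣ to a linear expression in m,
  -- which each proof below identifies with 3m + 2 or 3m + 4.
  pentMinus-pos : ∀ m → pentMinus (+ m) ≡ pentMinusℕ m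
  pentMinus-pos zero    = refl
  pentMinus-pos (suc m) = halve _ (trans (abs-* (+ suc m) (+ (m + 2 * suc m)))
                          (trans (cong (suc m *_) (m+2[1+m]≡3m+2 m)) (sym (pentMinusℕ-suc*2 m))))

  pentMinus-negsuc : ∀ m → pentMinus -[1+ m ] ≡ pentPlusℕ (suc m)
  pentMinus-negsuc m = halve _ (trans (abs-* -[1+ m ] ((+ 3) ℤ.* -[1+ m ] ℤ.- ℤ.1ℤ))
                       (trans (cong (suc m *_) (linear m)) (sym (pentPlusℕ-suc*2 m))))
    where
    linear : ∀ m → suc (suc (m + 2 * suc m + 0)) ≡ 3 * m + 4
    linear = solve-∀

  pentPlus-pos : ∀ m → pentPlus (+ m) ≡ pentPlusℕ m
  pentPlus-pos zero    = refl
  pentPlus-pos (suc m) = halve _ (trans (abs-* (+ suc m) ((+ 3) ℤ.* (+ suc m) ℤ.+ ℤ.1ℤ))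
                         (trans (cong (suc m *_) (linear m)) (sym (pentPlusℕ-suc*2 m))))
    where
    linear : ∀ m → suc (m + 2 * suc m + 1) ≡ 3 * m + 4
    linear = solve-∀

  pentPlus-negsuc : ∀ m → pentPlus -[1+ m ] ≡ pentMinusℕ (suc m)
  pentPlus-negsuc m = halve _ (trans (abs-* -[1+ m ] ((+ 3) ℤ.* -[1+ m ] ℤ.+ ℤ.1ℤ))
                      (trans (cong (suc m *_) (linear m)) (sym (pentMinusℕ-suc*2 m))))
    where
    linear : ∀ m → ∣ 1 ℤ.⊖ suc (m + 2 * suc m) ∣ ≡ 3 * m + 2
    linear m = trans (∣⊖∣-≤ (s≤s ℕ.z≤n)) (m+2[1+m]≡3m+2 m)

  pentPlusℕ+[k∸m]≡k+pentMinusℕ : ∀ {m k} → m ≤ k → pentPlusℕ m + (k ∸ m) ≡ k + pentMinusℕ m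
  pentPlusℕ+[k∸m]≡k+pentMinusℕ {m} {k} m≤k = begin
    pentMinusℕ m + m + (k ∸ m)   ≡⟨ ℕ.+-assoc (pentMinusℕ m) m (k ∸ m) ⟩
    pentMinusℕ m + (m + (k ∸ m)) ≡⟨ cong (λ x → pentMinusℕ m + x) (m+[n∸m]≡n m≤k) ⟩
    pentMinusℕ m + k               ≡⟨ ℕ.+-comm (pentMinusℕ m) k ⟩
    k + pentMinusℕ m ∎
    where open ≡.≡-Reasoning

  pentMinusℕ[1+m]+[k+m+2]≡1+k+pentPlusℕ[1+m] : ∀ m k →
    pentMinusℕ (suc m) + suc (k + suc m) ≡ suc k + pentPlusℕ (suc m)
  pentMinusℕ[1+m]+[k+m+2]≡1+k+pentPlusℕ[1+m] m k = linear (pentMinusℕ (suc m)) k m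
    where
    linear : ∀ p k m → p + suc (k + suc m) ≡ suc k + (p + suc m)
    linear = solve-∀

  pentPlusℕ+[k+m+1]≡pentMinusℕ[1+m]+[k∸m] : ∀ {m k} → m ≤ k →
    pentPlusℕ m + suc (k + m) ≡ pentMinusℕ (suc m) + (k ∸ m)
  pentPlusℕ+[k+m+1]≡pentMinusℕ[1+m]+[k∸m] {m} {k} m≤k = begin
    pentPlusℕ m + suc (k + m)
      ≡⟨ cong (λ k → pentPlusℕ m + suc (k + m)) (sym (m+[n∸m]≡n m≤k)) ⟩
    pentPlusℕ m + suc (m + (k ∸ m) + m)
      ≡⟨ linear (pentMinusℕ m) m (k ∸ m) ⟩
    pentMinusℕ (suc m) + (k ∸ m) ∎
    where
    open ≡.≡-Reasoning
    linear : ∀ p m d → p + m + suc (m + d + m) ≡ p + (3 * m + 1) + d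
    linear = solve-∀

  pentPlusℕ+[1+n∸[k∸m]]≡pentMinusℕ[1+m]+[n∸[k+m]] : ∀ {m k n} → m < k → k + m ≤ n →
    pentPlusℕ m + (suc n ∸ (k ∸ m)) ≡ pentMinusℕ (suc m) + (n ∸ (k + m))
  pentPlusℕ+[1+n∸[k∸m]]≡pentMinusℕ[1+m]+[n∸[k+m]] {m} {k} {n} m<k k+m≤n = begin
    pentPlusℕ m + (suc n ∸ (k ∸ m))   ≡⟨ cong (λ d → pentPlusℕ m + (suc n ∸ d)) k∸m≡1+e ⟩
    pentPlusℕ m + (n ∸ e)             ≡⟨ cong (λ x → pentPlusℕ m + x) n∸e≡1+2m+f ⟩
    pentPlusℕ m + suc (m + m + f) ≡⟨ linear (pentMinusℕ m) m f ⟩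
    pentMinusℕ (suc m) + f ∎
    where
    open ≡.≡-Reasoning
    e = k ∸ suc m
    f = n ∸ (k + m)
    k≡1+m+e : k ≡ suc m + e
    k≡1+m+e = sym (m+[n∸m]≡n m<k)
    k∸m≡1+e : k ∸ m ≡ suc e
    k∸m≡1+e = trans (cong (_∸ m) (trans k≡1+m+e (sym (ℕ.+-suc m e)))) (ℕ.m+n∸m≡n m (suc e))
    n≡e+[1+2m+f] : n ≡ e + suc (m + m + f)
    n≡e+[1+2m+f] = begin
      n                            ≡⟨ m+[n∸m]≡n k+m≤n ⟨
      k + m + f                ≡⟨ cong (λ k → k + m + f) k≡1+m+e ⟩
      suc m + e + m + f      ≡⟨ shuffle m e f ⟩
      e + suc (m + m + f) ∎
      where
      shuffle : ∀ m e f → suc m + e + m + f ≡ e + suc (m + m + f)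
      shuffle = solve-∀
    n∸e≡1+2m+f : n ∸ e ≡ suc (m + m + f)
    n∸e≡1+2m+f = trans (cong (_∸ e) n≡e+[1+2m+f]) (ℕ.m+n∸m≡n e _)
    linear : ∀ p m f → p + m + suc (m + m + f) ≡ p + (3 * m + 1) + f
    linear = solve-∀

open PentagonalNumbers

module RingLemmas {c ℓ} (R : CommutativeRing c ℓ) where
  open CommutativeRing R
  open import Algebra.Properties.Ring ring using (-1*x≈-x; -‿distribˡ-*)
  open import Relation.Binary.Reasoning.Setoid setoid

  zero-in-third-factor : ∀ {x y z w} → z ≈ 0# → x * y * z * w ≈ 0#
  zero-in-third-factor z≈0 = trans (*-congʳ (trans (*-congˡ z≈0) (zeroʳ _))) (zeroˡ _)

  zero-in-fourth-factor : ∀ {x y z w} → w ≈ 0# → x * y * z * w ≈ 0#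
  zero-in-fourth-factor w≈0 = trans (*-congˡ w≈0) (zeroʳ _)

  ≈0⇒*-congʳ : ∀ {x y z} → z ≈ 0# → x * z ≈ y * z
  ≈0⇒*-congʳ z≈0 = trans (*-congˡ z≈0) (trans (zeroʳ _) (sym (trans (*-congˡ z≈0) (zeroʳ _))))

  sign-cancel : ∀ s {x y} → x ≈ y → s * x + (- 1# * s) * y ≈ 0#
  sign-cancel s {x} {y} x≈y = begin
    s * x + (- 1# * s) * y   ≈⟨ +-congˡ (*-congʳ (-1*x≈-x s)) ⟩
    s * x + (- s) * y        ≈⟨ +-cong (*-congˡ x≈y) (sym (-‿distribˡ-* s y)) ⟩
    s * y + - (s * y)        ≈⟨ -‿inverseʳ (s * y) ⟩
    0#                       ∎

-n+[1+2n]≡1+n : ∀ n → ℤ.- (+ n) ℤ.+ + suc (n ℕ.+ n) ≡ + suc n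
-n+[1+2n]≡1+n n = begin
  ℤ.- (+ n) ℤ.+ + suc (n ℕ.+ n) ≡⟨ ≡.cong (λ x → ℤ.- (+ n) ℤ.+ + x) (ℕ.+-suc n n) ⟨
  ℤ.- (+ n) ℤ.+ + (n ℕ.+ suc n) ≡⟨ ZP.-m+n≡n⊖m n (n ℕ.+ suc n) ⟩
  n ℕ.+ suc n ℤ.⊖ n             ≡⟨ ZP.⊖-≥ (ℕ.m≤m+n n (suc n)) ⟩
  + (n ℕ.+ suc n ∸ n)           ≡⟨ ≡.cong +_ (ℕ.m+n∸m≡n n (suc n)) ⟩
  + suc n ∎
  where open ≡.≡-Reasoning

module SymmetricSums {c ℓ} (R : CommutativeRing c ℓ) where
  open CommutativeRing R
  open QSeries R using (sumRange)
  open import Algebra.Solver.Ring.NaturalCoefficients.Default commutativeSemiring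
  open import Relation.Binary.Reasoning.Setoid setoid

  sumRange-cong : ∀ lo len {f g : ℤ → Carrier} → (∀ j → f j ≈ g j) → sumRange lo len f ≈ sumRange lo len g
  sumRange-cong lo zero      f≈g = refl
  sumRange-cong lo (suc len) f≈g = +-cong (f≈g lo) (sumRange-cong (lo ℤ.+ ℤ.1ℤ) len f≈g)

  sumRange-zero : ∀ lo len {f : ℤ → Carrier} → (∀ j → f j ≈ 0#) → sumRange lo len f ≈ 0#
  sumRange-zero lo zero      f≈0 = refl
  sumRange-zero lo (suc len) f≈0 =
    trans (+-cong (f≈0 lo) (sumRange-zero (lo ℤ.+ ℤ.1ℤ) len f≈0)) (+-identityʳ 0#)

  sumRange-+ : ∀ lo len (f g : ℤ → Carrier) →
    sumRange lo len (λ j → f j + g j) ≈ sumRange lo len f + sumRange lo len g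
  sumRange-+ lo zero      f g = sym (+-identityʳ 0#)
  sumRange-+ lo (suc len) f g = trans (+-congˡ (sumRange-+ (lo ℤ.+ ℤ.1ℤ) len f g))
    (solve 4 (λ a b c d → (a :+ b) :+ (c :+ d) := (a :+ c) :+ (b :+ d)) refl (f lo) (g lo) _ _)

  sumRange-*ˡ : ∀ lo len x (f : ℤ → Carrier) → sumRange lo len (λ j → x * f j) ≈ x * sumRange lo len f
  sumRange-*ˡ lo zero      x f = sym (zeroʳ x)
  sumRange-*ˡ lo (suc len) x f = trans (+-congˡ (sumRange-*ˡ (lo ℤ.+ ℤ.1ℤ) len x f)) (sym (distribˡ x _ _))

  sumRange-snoc : ∀ lo len (f : ℤ → Carrier) → sumRange lo (suc len) f ≈ sumRange lo len f + f (lo ℤ.+ + len)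
  sumRange-snoc lo zero      f = begin
    f lo + 0#            ≈⟨ +-identityʳ (f lo) ⟩
    f lo                 ≡⟨ ≡.cong f (ZP.+-identityʳ lo) ⟨
    f (lo ℤ.+ + 0)       ≈⟨ +-identityˡ _ ⟨
    0# + f (lo ℤ.+ + 0)  ∎
  sumRange-snoc lo (suc len) f = begin
    f lo + sumRange (lo ℤ.+ ℤ.1ℤ) (suc len) f
      ≈⟨ +-congˡ (sumRange-snoc (lo ℤ.+ ℤ.1ℤ) len f) ⟩
    f lo + (sumRange (lo ℤ.+ ℤ.1ℤ) len f + f (lo ℤ.+ ℤ.1ℤ ℤ.+ + len))
      ≈⟨ +-assoc _ _ _ ⟨
    sumRange lo (suc len) f + f (lo ℤ.+ ℤ.1ℤ ℤ.+ + len)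
      ≡⟨ ≡.cong (λ j → sumRange lo (suc len) f + f j) (ZP.+-assoc lo ℤ.1ℤ (+ len)) ⟩
    sumRange lo (suc len) f + f (lo ℤ.+ + suc len) ∎

  symSum : ℕ → (ℤ → Carrier) → Carrier
  symSum N = sumRange (ℤ.- (+ N)) (suc (N ℕ.+ N))

  symSum-suc : ∀ N f → symSum (suc N) f ≈ f -[1+ N ] + (symSum N f + f (+ suc N))
  symSum-suc N f = +-congˡ (begin
    sumRange (-[1+ N ] ℤ.+ ℤ.1ℤ) (suc N ℕ.+ suc N) f
      ≡⟨ ≡.cong₂ (λ lo len → sumRange lo len f) lo≡-N (≡.cong suc (ℕ.+-suc N N)) ⟩
    sumRange (ℤ.- (+ N)) (suc (suc (N ℕ.+ N))) f
      ≈⟨ sumRange-snoc (ℤ.- (+ N)) (suc (N ℕ.+ N)) f ⟩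
    symSum N f + f (ℤ.- (+ N) ℤ.+ + suc (N ℕ.+ N))
      ≡⟨ ≡.cong (λ j → symSum N f + f j) (-n+[1+2n]≡1+n N) ⟩
    symSum N f + f (+ suc N) ∎)
    where
    lo≡-N : -[1+ N ] ℤ.+ ℤ.1ℤ ≡ ℤ.- (+ N)
    lo≡-N = ≡.trans (ZP.+-comm -[1+ N ] ℤ.1ℤ) (ZP.1-[1+n]≡-n N)

  symSum-reflect : ∀ N f → symSum N (λ j → f (ℤ.- j)) ≈ symSum N f
  symSum-reflect zero    f = refl
  symSum-reflect (suc N) f = begin
    symSum (suc N) (λ j → f (ℤ.- j))
      ≈⟨ symSum-suc N _ ⟩
    f (+ suc N) + (symSum N (λ j → f (ℤ.- j)) + f -[1+ N ])
      ≈⟨ +-congˡ (+-congʳ (symSum-reflect N f)) ⟩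
    f (+ suc N) + (symSum N f + f -[1+ N ])
      ≈⟨ solve 3 (λ a b c → a :+ (b :+ c) := c :+ (b :+ a)) refl _ _ _ ⟩
    f -[1+ N ] + (symSum N f + f (+ suc N))
      ≈⟨ symSum-suc N f ⟨
    symSum (suc N) f ∎

  symSum-shrink : ∀ N f → f -[1+ N ] ≈ 0# → f (+ suc N) ≈ 0# → symSum (suc N) f ≈ symSum N f
  symSum-shrink N f f₋≈0 f₊≈0 = begin
    symSum (suc N) f                        ≈⟨ symSum-suc N f ⟩
    f -[1+ N ] + (symSum N f + f (+ suc N)) ≈⟨ +-cong f₋≈0 (+-congˡ f₊≈0) ⟩
    0# + (symSum N f + 0#)                  ≈⟨ trans (+-identityˡ _) (+-identityʳ _) ⟩
    symSum N f                              ∎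

  pairSum : ℕ → (ℤ → Carrier) → Carrier
  pairSum zero    f = f (+ 0) + f -[1+ 0 ]
  pairSum (suc N) f = pairSum N f + (f (+ suc N) + f -[1+ suc N ])

  pairSum-cong : ∀ N {f g : ℤ → Carrier} →
    (∀ m → f (+ m) + f -[1+ m ] ≈ g (+ m) + g -[1+ m ]) → pairSum N f ≈ pairSum N g
  pairSum-cong zero    pairs = pairs 0
  pairSum-cong (suc N) pairs = +-cong (pairSum-cong N pairs) (pairs (suc N))

  pairSum≈symSum : ∀ N f → f -[1+ N ] ≈ 0# → pairSum N f ≈ symSum N f
  pairSum≈symSum N f f₋≈0 = begin
    pairSum N f                ≈⟨ symSum+≈pairSum N ⟨
    symSum N f + f -[1+ N ]    ≈⟨ +-congˡ f₋≈0 ⟩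
    symSum N f + 0#            ≈⟨ +-identityʳ _ ⟩
    symSum N f                 ∎
    where
    symSum+≈pairSum : ∀ N → symSum N f + f -[1+ N ] ≈ pairSum N f
    symSum+≈pairSum zero    = +-congʳ (+-identityʳ _)
    symSum+≈pairSum (suc N) = begin
      symSum (suc N) f + f -[1+ suc N ]
        ≈⟨ +-congʳ (symSum-suc N f) ⟩
      (f -[1+ N ] + (symSum N f + f (+ suc N))) + f -[1+ suc N ]
        ≈⟨ solve 4 (λ a b c d → (a :+ (b :+ c)) :+ d := (b :+ a) :+ (c :+ d)) refl _ _ _ _ ⟩
      (symSum N f + f -[1+ N ]) + (f (+ suc N) + f -[1+ suc N ])
        ≈⟨ +-congʳ (symSum+≈pairSum N) ⟩
      pairSum (suc N) f ∎

module QBinomials {c ℓ} (R : CommutativeRing c ℓ) (q : CommutativeRing.Carrier R) where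
  open CommutativeRing R hiding (zero)
  open QSeries R
  open RingLemmas R
  open import Algebra.Solver.Ring.NaturalCoefficients.Default commutativeSemiring
  open import Relation.Binary.Reasoning.Setoid setoid

  pow-+ : ∀ a b → pow q (a ℕ.+ b) ≈ pow q a * pow q b
  pow-+ zero    b = sym (*-identityˡ _)
  pow-+ (suc a) b = trans (*-congˡ (pow-+ a b)) (sym (*-assoc _ _ _))

  pow*pow-cong : ∀ a b a′ b′ → a ℕ.+ b ≡ a′ ℕ.+ b′ → pow q a * pow q b ≈ pow q a′ * pow q b′
  pow*pow-cong a b a′ b′ eq = begin
    pow q a * pow q b     ≈⟨ pow-+ a b ⟨
    pow q (a ℕ.+ b)       ≡⟨ ≡.cong (pow q) eq ⟩
    pow q (a′ ℕ.+ b′)     ≈⟨ pow-+ a′ b′ ⟩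
    pow q a′ * pow q b′   ∎

  qbinℕ-vanish : ∀ {n r} → n < r → qbinℕ q n r ≈ 0#
  qbinℕ-vanish {zero}  {suc r} _         = refl
  qbinℕ-vanish {suc n} {suc r} (s≤s n<r) = begin
    qbinℕ q n r + pow q (suc r) * qbinℕ q n (suc r)
      ≈⟨ +-cong (qbinℕ-vanish n<r) (*-congˡ (qbinℕ-vanish (ℕ.m<n⇒m<1+n n<r))) ⟩
    0# + pow q (suc r) * 0#
      ≈⟨ trans (+-identityˡ _) (zeroʳ _) ⟩
    0# ∎

  qbinℕ-pascal′ : ∀ n r → qbinℕ q (suc n) (suc r) ≈ pow q (n ∸ r) * qbinℕ q n r + qbinℕ q n (suc r)
  qbinℕ-pascal′ zero    zero    = solve 1 (λ x → con 1 :+ x :* con 1 :* con 0 := con 1 :* con 1 :+ con 0) refl q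
  qbinℕ-pascal′ zero    (suc r) =
    solve 1 (λ Q → con 0 :+ Q :* con 0 := con 1 :* con 0 :+ con 0) refl (pow q (suc (suc r)))
  qbinℕ-pascal′ (suc n) zero    = begin
    1# + pow q 1 * qbinℕ q (suc n) 1
      ≈⟨ +-congˡ (*-congˡ (qbinℕ-pascal′ n zero)) ⟩
    1# + pow q 1 * (pow q n * 1# + qbinℕ q n 1)
      ≈⟨ solve 3 (λ x Q B → con 1 :+ x :* con 1 :* (Q :* con 1 :+ B) := x :* Q :* con 1 :+ (con 1 :+ x :* con 1 :* B))
               refl q (pow q n) (qbinℕ q n 1) ⟩
    pow q (suc n) * 1# + qbinℕ q (suc n) 1 ∎
  qbinℕ-pascal′ (suc n) (suc r) = begin
    qbinℕ q (suc n) (suc r) + pow q (suc (suc r)) * qbinℕ q (suc n) (suc (suc r))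
      ≈⟨ +-cong (qbinℕ-pascal′ n r) (*-congˡ (qbinℕ-pascal′ n (suc r))) ⟩
    (E * A + B) + q * Q * (F * B + C)
      ≈⟨ solve 7 (λ x E A B Q F C → (E :* A :+ B) :+ x :* Q :* (F :* B :+ C)
                                    := E :* A :+ (B :+ x :* Q :* C) :+ (x :* F) :* Q :* B)
               refl q E A B Q F C ⟩
    E * A + (B + q * Q * C) + (q * F) * Q * B
      ≈⟨ +-congˡ cross-term ⟩
    E * A + (B + q * Q * C) + E * Q * B
      ≈⟨ solve 5 (λ E A B Q D → E :* A :+ D :+ E :* Q :* B := E :* (A :+ Q :* B) :+ D)
               refl E A B Q (B + q * Q * C) ⟩
    E * (A + Q * B) + (B + q * Q * C) ∎
    where
    E = pow q (n ∸ r)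
    F = pow q (n ∸ suc r)
    Q = pow q (suc r)
    A = qbinℕ q n r
    B = qbinℕ q n (suc r)
    C = qbinℕ q n (suc (suc r))
    cross-term : (q * F) * Q * B ≈ E * Q * B
    cross-term with r ℕ.<? n
    ... | yes r<n = *-congʳ (*-congʳ (reflexive (≡.cong (pow q) (≡.sym (ℕ.+-∸-assoc 1 r<n)))))
    ... | no  r≮n = ≈0⇒*-congʳ (qbinℕ-vanish (s≤s (ℕ.≮⇒≥ r≮n)))

  -- qbin∸ n k m is [n, k - m], with the convention that it is 0 when m > k.
  qbin∸ : ℕ → ℕ → ℕ → Carrier
  qbin∸ n k       zero    = qbinℕ q n k
  qbin∸ n zero    (suc m) = 0#
  qbin∸ n (suc k) (suc m) = qbin∸ n k m

  qbin∸-vanish : ∀ n {k m} → k < m → qbin∸ n k m ≈ 0#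
  qbin∸-vanish n {zero}  {suc m} _         = refl
  qbin∸-vanish n {suc k} {suc m} (s≤s k<m) = qbin∸-vanish n k<m

  qbin[k⊖m]≡qbin∸ : ∀ n k m → qbin q (+ n) (k ℤ.⊖ m) ≡ qbin∸ n k m
  qbin[k⊖m]≡qbin∸ n k       zero    = ≡.refl
  qbin[k⊖m]≡qbin∸ n zero    (suc m) = ≡.refl
  qbin[k⊖m]≡qbin∸ n (suc k) (suc m) =
    ≡.trans (≡.cong (qbin q (+ n)) (ZP.[1+m]⊖[1+n]≡m⊖n k m)) (qbin[k⊖m]≡qbin∸ n k m)

  qbin[k-m]≡qbin∸ : ∀ n k m → qbin q (+ n) (+ k ℤ.- + m) ≡ qbin∸ n k m
  qbin[k-m]≡qbin∸ n k m = ≡.trans (≡.cong (qbin q (+ n)) (ZP.m-n≡m⊖n k m)) (qbin[k⊖m]≡qbin∸ n k m)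

  qbin[k⊖1+m+1]≡qbin∸ : ∀ n k m → qbin q (+ n) ((k ℤ.⊖ suc m) ℤ.+ + 1) ≡ qbin∸ n k m
  qbin[k⊖1+m+1]≡qbin∸ n zero    zero    = ≡.refl
  qbin[k⊖1+m+1]≡qbin∸ n zero    (suc m) = ≡.refl
  qbin[k⊖1+m+1]≡qbin∸ n (suc k) zero    = ≡.cong (qbinℕ q n) (ℕ.+-comm k 1)
  qbin[k⊖1+m+1]≡qbin∸ n (suc k) (suc m) =
    ≡.trans (≡.cong (λ j → qbin q (+ n) (j ℤ.+ + 1)) (ZP.[1+m]⊖[1+n]≡m⊖n k (suc m)))
            (qbin[k⊖1+m+1]≡qbin∸ n k m)

  qbin∸-pascal : ∀ n k m → qbin∸ (suc n) k m ≈ qbin∸ n k (suc m) + pow q (k ∸ m) * qbin∸ n k m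
  qbin∸-pascal n zero    zero    = sym (trans (+-identityˡ _) (*-identityˡ 1#))
  qbin∸-pascal n (suc k) zero    = refl
  qbin∸-pascal n zero    (suc m) = sym (trans (+-identityˡ _) (zeroʳ _))
  qbin∸-pascal n (suc k) (suc m) = qbin∸-pascal n k m

  qbin∸-pascal′ : ∀ n k m → qbin∸ (suc n) k m ≈ qbin∸ n k m + pow q (suc n ∸ (k ∸ m)) * qbin∸ n k (suc m)
  qbin∸-pascal′ n zero    zero    = sym (trans (+-congˡ (zeroʳ _)) (+-identityʳ _))
  qbin∸-pascal′ n (suc k) zero    = trans (qbinℕ-pascal′ n k) (+-comm _ _)
  qbin∸-pascal′ n zero    (suc m) = sym (trans (+-congˡ (zeroʳ _)) (+-identityʳ _))
  qbin∸-pascal′ n (suc k) (suc m) = qbin∸-pascal′ n k m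

module PentagonalSums {c ℓ} (R : CommutativeRing c ℓ) (q : CommutativeRing.Carrier R) where
  open CommutativeRing R hiding (zero)
  open QSeries R
  open RingLemmas R
  open SymmetricSums R
  open QBinomials R q
  open import Algebra.Solver.Ring.NaturalCoefficients.Default commutativeSemiring
  open import Relation.Binary.Reasoning.Setoid setoid

  termA termB termC : ℕ → ℕ → ℤ → Carrier
  termA n k j = signPow j * pow q (pentMinus j) * qbin q (+ n) (+ k ℤ.- j) * qbin q (+ n) (+ k ℤ.+ j)
  termB n k j = signPow j * pow q (pentMinus j) * qbin q (+ n) (+ k ℤ.- j) * qbin q (+ suc n) (+ k ℤ.+ j)
  termC n k j = signPow j * pow q (pentPlus j) * qbin q (+ n) (+ k ℤ.- j) * qbin q (+ suc n) (+ k ℤ.+ j ℤ.+ + 1)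

  termA-pos : ∀ n k m → termA n k (+ m) ≡
    negOnePowℕ m * pow q (pentMinusℕ m) * qbin∸ n k m * qbinℕ q n (k ℕ.+ m)
  termA-pos n k m rewrite pentMinus-pos m | qbin[k-m]≡qbin∸ n k m = ≡.refl

  termA-negsuc : ∀ n k m → termA n k -[1+ m ] ≡
    negOnePowℕ (suc m) * pow q (pentPlusℕ (suc m)) * qbinℕ q n (k ℕ.+ suc m) * qbin∸ n k (suc m)
  termA-negsuc n k m rewrite pentMinus-negsuc m | qbin[k⊖m]≡qbin∸ n k (suc m) = ≡.refl

  termA-neg : ∀ n k m → termA n k (ℤ.- (+ m)) ≈
    negOnePowℕ m * pow q (pentPlusℕ m) * qbinℕ q n (k ℕ.+ m) * qbin∸ n k m
  termA-neg n k zero    =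
    trans (reflexive (termA-pos n k 0)) (solve 4 (λ a b c d → a :* b :* c :* d := a :* b :* d :* c) refl _ _ _ _)
  termA-neg n k (suc m) = reflexive (termA-negsuc n k m)

  termB-pos : ∀ n k m → termB n k (+ m) ≡
    negOnePowℕ m * pow q (pentMinusℕ m) * qbin∸ n k m * qbinℕ q (suc n) (k ℕ.+ m)
  termB-pos n k m rewrite pentMinus-pos m | qbin[k-m]≡qbin∸ n k m = ≡.refl

  termB-negsuc : ∀ n k m → termB n k -[1+ m ] ≡
    negOnePowℕ (suc m) * pow q (pentPlusℕ (suc m)) * qbinℕ q n (k ℕ.+ suc m) * qbin∸ (suc n) k (suc m)
  termB-negsuc n k m rewrite pentMinus-negsuc m | qbin[k⊖m]≡qbin∸ (suc n) k (suc m) = ≡.refl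

  termB-neg : ∀ n k m → termB n k (ℤ.- (+ m)) ≈
    negOnePowℕ m * pow q (pentPlusℕ m) * qbinℕ q n (k ℕ.+ m) * qbin∸ (suc n) k m
  termB-neg n k zero    rewrite ℕ.+-identityʳ k = refl
  termB-neg n k (suc m) = reflexive (termB-negsuc n k m)

  termC-pos : ∀ n k m → termC n k (+ m) ≡
    negOnePowℕ m * pow q (pentPlusℕ m) * qbin∸ n k m * qbinℕ q (suc n) (suc (k ℕ.+ m))
  termC-pos n k m rewrite pentPlus-pos m | qbin[k-m]≡qbin∸ n k m | ℕ.+-comm (k ℕ.+ m) 1 = ≡.refl

  termC-negsuc : ∀ n k m → termC n k -[1+ m ] ≡
    negOnePowℕ (suc m) * pow q (pentMinusℕ (suc m)) * qbinℕ q n (k ℕ.+ suc m) * qbin∸ (suc n) k m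
  termC-negsuc n k m rewrite pentPlus-negsuc m | qbin[k⊖1+m+1]≡qbin∸ (suc n) k m = ≡.refl

  termA-pos-vanish : ∀ n {k m} → k < m → termA n k (+ m) ≈ 0#
  termA-pos-vanish n {k} {m} k<m =
    trans (reflexive (termA-pos n k m)) (zero-in-third-factor (qbin∸-vanish n k<m))

  termA-negsuc-vanish : ∀ n {k m} → k ≤ m → termA n k -[1+ m ] ≈ 0#
  termA-negsuc-vanish n {k} {m} k≤m =
    trans (reflexive (termA-negsuc n k m)) (zero-in-fourth-factor (qbin∸-vanish n (s≤s k≤m)))

  termB-pos-vanish : ∀ n {k m} → k < m → termB n k (+ m) ≈ 0#
  termB-pos-vanish n {k} {m} k<m =
    trans (reflexive (termB-pos n k m)) (zero-in-third-factor (qbin∸-vanish n k<m))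

  termB-negsuc-vanish : ∀ n {k m} → k ≤ m → termB n k -[1+ m ] ≈ 0#
  termB-negsuc-vanish n {k} {m} k≤m =
    trans (reflexive (termB-negsuc n k m)) (zero-in-fourth-factor (qbin∸-vanish (suc n) (s≤s k≤m)))

  termC-negsuc-vanish : ∀ n {k m} → k < m → termC n k -[1+ m ] ≈ 0#
  termC-negsuc-vanish n {k} {m} k<m =
    trans (reflexive (termC-negsuc n k m)) (zero-in-fourth-factor (qbin∸-vanish (suc n) k<m))

  termC-pair : ∀ n k m → termC n k (+ m) + termC n k -[1+ m ] ≈ termA n k (ℤ.- (+ m)) + termA n k (+ suc m)
  termC-pair n k m = begin
    termC n k (+ m) + termC n k -[1+ m ]
      ≡⟨ ≡.cong₂ _+_ (termC-pos n k m) (termC-negsuc n k m) ⟩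
    s * P * X * (Y + Qa * Y₁) + t * P′ * qbinℕ q n (k ℕ.+ suc m) * qbin∸ (suc n) k m
      ≈⟨ +-congˡ (*-cong (*-congˡ Y₁-index) (qbin∸-pascal n k m)) ⟩
    s * P * X * (Y + Qa * Y₁) + t * P′ * Y₁ * (X₁ + Qb * X)
      ≈⟨ solve 10 (λ s P X Y Qa Y₁ t P′ X₁ Qb →
           s :* P :* X :* (Y :+ Qa :* Y₁) :+ t :* P′ :* Y₁ :* (X₁ :+ Qb :* X)
           := (s :* P :* Y :* X :+ t :* P′ :* X₁ :* Y₁)
              :+ (s :* (P :* Qa :* (X :* Y₁)) :+ t :* (P′ :* Qb :* (X :* Y₁))))
         refl s P X Y Qa Y₁ t P′ X₁ Qb ⟩
    (s * P * Y * X + t * P′ * X₁ * Y₁) + (s * (P * Qa * (X * Y₁)) + t * (P′ * Qb * (X * Y₁)))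
      ≈⟨ trans (+-congˡ (sign-cancel s cross-terms)) (+-identityʳ _) ⟩
    s * P * Y * X + t * P′ * X₁ * Y₁
      ≈⟨ +-cong (termA-neg n k m) (trans (reflexive (termA-pos n k (suc m))) (*-congˡ Y₁-index)) ⟨
    termA n k (ℤ.- (+ m)) + termA n k (+ suc m) ∎
    where
    s = negOnePowℕ m
    t = negOnePowℕ (suc m)
    P = pow q (pentPlusℕ m)
    P′ = pow q (pentMinusℕ (suc m))
    Qa = pow q (suc (k ℕ.+ m))
    Qb = pow q (k ∸ m)
    X = qbin∸ n k m
    X₁ = qbin∸ n k (suc m)
    Y = qbinℕ q n (k ℕ.+ m)
    Y₁ = qbinℕ q n (suc (k ℕ.+ m))
    Y₁-index : qbinℕ q n (k ℕ.+ suc m) ≈ Y₁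
    Y₁-index = reflexive (≡.cong (qbinℕ q n) (ℕ.+-suc k m))
    cross-terms : P * Qa * (X * Y₁) ≈ P′ * Qb * (X * Y₁)
    cross-terms with m ℕ.≤? k
    ... | yes m≤k = *-congʳ (pow*pow-cong (pentPlusℕ m) (suc (k ℕ.+ m)) (pentMinusℕ (suc m)) (k ∸ m)
                                          (pentPlusℕ+[k+m+1]≡pentMinusℕ[1+m]+[k∸m] m≤k))
    ... | no  m≰k = ≈0⇒*-congʳ (trans (*-congʳ (qbin∸-vanish n (ℕ.≰⇒> m≰k))) (zeroˡ _))

  termB-pair : ∀ n k m → termB n k (ℤ.- (+ m)) + termB n k (+ suc m) ≈ termA n k (ℤ.- (+ m)) + termA n k (+ suc m)
  termB-pair n k m = begin
    termB n k (ℤ.- (+ m)) + termB n k (+ suc m)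
      ≈⟨ +-cong (termB-neg n k m) (reflexive (termB-pos n k (suc m))) ⟩
    s * P * Y * qbin∸ (suc n) k m + t * P′ * X₁ * qbinℕ q (suc n) (k ℕ.+ suc m)
      ≈⟨ +-cong (*-congˡ (qbin∸-pascal′ n k m))
                (*-congˡ (trans (reflexive (≡.cong (qbinℕ q (suc n)) (ℕ.+-suc k m)))
                                (qbinℕ-pascal′ n (k ℕ.+ m)))) ⟩
    s * P * Y * (X + Qc * X₁) + t * P′ * X₁ * (Qd * Y + Y₁)
      ≈⟨ solve 10 (λ s P X Y Qc Y₁ t P′ X₁ Qd →
           s :* P :* Y :* (X :+ Qc :* X₁) :+ t :* P′ :* X₁ :* (Qd :* Y :+ Y₁)
           := (s :* P :* Y :* X :+ t :* P′ :* X₁ :* Y₁)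
              :+ (s :* (P :* Qc :* (Y :* X₁)) :+ t :* (P′ :* Qd :* (Y :* X₁))))
         refl s P X Y Qc Y₁ t P′ X₁ Qd ⟩
    (s * P * Y * X + t * P′ * X₁ * Y₁) + (s * (P * Qc * (Y * X₁)) + t * (P′ * Qd * (Y * X₁)))
      ≈⟨ trans (+-congˡ (sign-cancel s cross-terms)) (+-identityʳ _) ⟩
    s * P * Y * X + t * P′ * X₁ * Y₁
      ≈⟨ +-cong (termA-neg n k m) (trans (reflexive (termA-pos n k (suc m))) (*-congˡ Y₁-index)) ⟨
    termA n k (ℤ.- (+ m)) + termA n k (+ suc m) ∎
    where
    s = negOnePowℕ m
    t = negOnePowℕ (suc m)
    P = pow q (pentPlusℕ m)
    P′ = pow q (pentMinusℕ (suc m))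
    Qc = pow q (suc n ∸ (k ∸ m))
    Qd = pow q (n ∸ (k ℕ.+ m))
    X = qbin∸ n k m
    X₁ = qbin∸ n k (suc m)
    Y = qbinℕ q n (k ℕ.+ m)
    Y₁ = qbinℕ q n (suc (k ℕ.+ m))
    Y₁-index : qbinℕ q n (k ℕ.+ suc m) ≈ Y₁
    Y₁-index = reflexive (≡.cong (qbinℕ q n) (ℕ.+-suc k m))
    cross-terms : P * Qc * (Y * X₁) ≈ P′ * Qd * (Y * X₁)
    cross-terms with m ℕ.<? k | k ℕ.+ m ℕ.≤? n
    ... | yes m<k | yes k+m≤n =
      *-congʳ (pow*pow-cong (pentPlusℕ m) (suc n ∸ (k ∸ m)) (pentMinusℕ (suc m)) (n ∸ (k ℕ.+ m))
                            (pentPlusℕ+[1+n∸[k∸m]]≡pentMinusℕ[1+m]+[n∸[k+m]] m<k k+m≤n))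
    ... | _       | no  k+m≰n =
      ≈0⇒*-congʳ (trans (*-congʳ (qbinℕ-vanish (ℕ.≰⇒> k+m≰n))) (zeroˡ _))
    ... | no  m≮k | yes _     =
      ≈0⇒*-congʳ (trans (*-congˡ (qbin∸-vanish n (s≤s (ℕ.≮⇒≥ m≮k)))) (zeroʳ _))

  termA-recurrence : ∀ n k j → termA (suc n) (suc k) (ℤ.- j) ≈ termC n k j + pow q (suc k) * termB n (suc k) j
  termA-recurrence n k (+ m) = begin
    termA (suc n) (suc k) (ℤ.- (+ m))
      ≈⟨ termA-neg (suc n) (suc k) m ⟩
    s * P * Y * qbin∸ (suc n) (suc k) m
      ≈⟨ *-congˡ (qbin∸-pascal n (suc k) m) ⟩
    s * P * Y * (X₁ + Qb * X)
      ≈⟨ solve 6 (λ s P Y X₁ Qb X → s :* P :* Y :* (X₁ :+ Qb :* X)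
                                  := s :* P :* X₁ :* Y :+ s :* (P :* Qb :* (Y :* X)))
               refl s P Y X₁ Qb X ⟩
    s * P * X₁ * Y + s * (P * Qb * (Y * X))
      ≈⟨ +-congˡ (*-congˡ cross-term) ⟩
    s * P * X₁ * Y + s * (K * Pₘ * (Y * X))
      ≈⟨ +-congˡ (solve 5 (λ s K Pₘ Y X → s :* (K :* Pₘ :* (Y :* X)) := K :* (s :* Pₘ :* X :* Y))
                          refl s K Pₘ Y X) ⟩
    s * P * X₁ * Y + K * (s * Pₘ * X * Y)
      ≡⟨ ≡.cong₂ (λ c b → c + K * b) (termC-pos n k m) (termB-pos n (suc k) m) ⟨
    termC n k (+ m) + K * termB n (suc k) (+ m) ∎
    where
    s = negOnePowℕ m
    K = pow q (suc k)
    P = pow q (pentPlusℕ m)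
    Pₘ = pow q (pentMinusℕ m)
    Qb = pow q (suc k ∸ m)
    X = qbin∸ n (suc k) m
    X₁ = qbin∸ n k m
    Y = qbinℕ q (suc n) (suc (k ℕ.+ m))
    cross-term : P * Qb * (Y * X) ≈ K * Pₘ * (Y * X)
    cross-term with m ℕ.≤? suc k
    ... | yes m≤k = *-congʳ (pow*pow-cong (pentPlusℕ m) (suc k ∸ m) (suc k) (pentMinusℕ m)
                                          (pentPlusℕ+[k∸m]≡k+pentMinusℕ m≤k))
    ... | no  m≰k = ≈0⇒*-congʳ (trans (*-congˡ (qbin∸-vanish n (ℕ.≰⇒> m≰k))) (zeroʳ _))
  termA-recurrence n k -[1+ m ] = begin
    termA (suc n) (suc k) (+ suc m)
      ≡⟨ termA-pos (suc n) (suc k) (suc m) ⟩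
    t * P′ * Z * (Y + Qe * Y₁)
      ≈⟨ solve 6 (λ t P′ Z Y Qe Y₁ → t :* P′ :* Z :* (Y :+ Qe :* Y₁)
                                   := t :* P′ :* Y :* Z :+ t :* (P′ :* Qe) :* (Y₁ :* Z))
               refl t P′ Z Y Qe Y₁ ⟩
    t * P′ * Y * Z + t * (P′ * Qe) * (Y₁ * Z)
      ≈⟨ +-congˡ (*-congʳ (*-congˡ cross-factor)) ⟩
    t * P′ * Y * Z + t * (K * P) * (Y₁ * Z)
      ≈⟨ +-congˡ (solve 5 (λ t K P Y₁ Z → t :* (K :* P) :* (Y₁ :* Z) := K :* (t :* P :* Y₁ :* Z))
                          refl t K P Y₁ Z) ⟩
    t * P′ * Y * Z + K * (t * P * Y₁ * Z)
      ≡⟨ ≡.cong₂ (λ c b → c + K * b) (termC-negsuc n k m) (termB-negsuc n (suc k) m) ⟨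
    termC n k -[1+ m ] + K * termB n (suc k) -[1+ m ] ∎
    where
    t = negOnePowℕ (suc m)
    K = pow q (suc k)
    P = pow q (pentPlusℕ (suc m))
    P′ = pow q (pentMinusℕ (suc m))
    Qe = pow q (suc (k ℕ.+ suc m))
    Z = qbin∸ (suc n) k m
    Y = qbinℕ q n (k ℕ.+ suc m)
    Y₁ = qbinℕ q n (suc (k ℕ.+ suc m))
    cross-factor : P′ * Qe ≈ K * P
    cross-factor = pow*pow-cong (pentMinusℕ (suc m)) (suc (k ℕ.+ suc m)) (suc k) (pentPlusℕ (suc m))
                                (pentMinusℕ[1+m]+[k+m+2]≡1+k+pentPlusℕ[1+m] m k)

  sumA sumB sumC : ℕ → ℕ → Carrier
  sumA n k = symSum k (termA n k)
  sumB n k = symSum (suc k) (termB n k)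
  sumC n k = symSum (suc k) (termC n k)

  pairSum-termA-reflected : ∀ n k → pairSum (suc k) (λ j → termA n k (ℤ.- j)) ≈ sumA n k
  pairSum-termA-reflected n k = begin
    pairSum (suc k) (λ j → termA n k (ℤ.- j))
      ≈⟨ pairSum≈symSum (suc k) _ (termA-pos-vanish n (ℕ.m<n⇒m<1+n (ℕ.n<1+n k))) ⟩
    symSum (suc k) (λ j → termA n k (ℤ.- j))
      ≈⟨ symSum-reflect (suc k) (termA n k) ⟩
    symSum (suc k) (termA n k)
      ≈⟨ symSum-shrink k (termA n k) (termA-negsuc-vanish n (ℕ.≤-refl {k})) (termA-pos-vanish n (ℕ.n<1+n k)) ⟩
    sumA n k ∎

  sumC≈sumA : ∀ n k → sumC n k ≈ sumA n k
  sumC≈sumA n k = begin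
    symSum (suc k) (termC n k)
      ≈⟨ pairSum≈symSum (suc k) (termC n k) (termC-negsuc-vanish n (ℕ.n<1+n k)) ⟨
    pairSum (suc k) (termC n k)
      ≈⟨ pairSum-cong (suc k) (termC-pair n k) ⟩
    pairSum (suc k) (λ j → termA n k (ℤ.- j))
      ≈⟨ pairSum-termA-reflected n k ⟩
    sumA n k ∎

  sumB≈sumA : ∀ n k → sumB n k ≈ sumA n k
  sumB≈sumA n k = begin
    symSum (suc k) (termB n k)
      ≈⟨ symSum-reflect (suc k) (termB n k) ⟨
    symSum (suc k) (λ j → termB n k (ℤ.- j))
      ≈⟨ pairSum≈symSum (suc k) _ (termB-pos-vanish n (ℕ.m<n⇒m<1+n (ℕ.n<1+n k))) ⟨
    pairSum (suc k) (λ j → termB n k (ℤ.- j))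
      ≈⟨ pairSum-cong (suc k) (termB-pair n k) ⟩
    pairSum (suc k) (λ j → termA n k (ℤ.- j))
      ≈⟨ pairSum-termA-reflected n k ⟩
    sumA n k ∎

  sumA-pascal : ∀ n k → sumA (suc n) (suc k) ≈ sumA n k + pow q (suc k) * sumA n (suc k)
  sumA-pascal n k = begin
    symSum (suc k) (termA (suc n) (suc k))
      ≈⟨ symSum-reflect (suc k) (termA (suc n) (suc k)) ⟨
    symSum (suc k) (λ j → termA (suc n) (suc k) (ℤ.- j))
      ≈⟨ sumRange-cong lo len (termA-recurrence n k) ⟩
    symSum (suc k) (λ j → termC n k j + K * termB n (suc k) j)
      ≈⟨ sumRange-+ lo len (termC n k) (λ j → K * termB n (suc k) j) ⟩
    sumC n k + symSum (suc k) (λ j → K * termB n (suc k) j)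
      ≈⟨ +-cong (sumC≈sumA n k) (sumRange-*ˡ lo len K (termB n (suc k))) ⟩
    sumA n k + K * symSum (suc k) (termB n (suc k))
      ≈⟨ +-congˡ (*-congˡ (trans (sym (symSum-shrink (suc k) (termB n (suc k)) termB-vanish₋ termB-vanish₊))
                                 (sumB≈sumA n (suc k)))) ⟩
    sumA n k + K * sumA n (suc k) ∎
    where
    lo = ℤ.- (+ suc k)
    len = suc (suc k ℕ.+ suc k)
    K = pow q (suc k)
    termB-vanish₋ = termB-negsuc-vanish n (ℕ.≤-refl {suc k})
    termB-vanish₊ = termB-pos-vanish n (ℕ.n<1+n (suc k))

  sumA≈qbinℕ : ∀ n k → sumA n k ≈ qbinℕ q n k
  sumA≈qbinℕ n       zero    = trans (+-identityʳ _) (solve 0 (con 1 :* con 1 :* con 1 :* con 1 := con 1) refl)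
  sumA≈qbinℕ zero    (suc k) = sumRange-zero (ℤ.- (+ suc k)) (suc (suc k ℕ.+ suc k)) vanish
    where
    vanish : ∀ j → termA zero (suc k) j ≈ 0#
    vanish (+ m)      = trans (reflexive (termA-pos zero (suc k) m)) (zero-in-fourth-factor refl)
    vanish -[1+ m ]   = trans (reflexive (termA-negsuc zero (suc k) m)) (zero-in-third-factor refl)
  sumA≈qbinℕ (suc n) (suc k) = begin
    sumA (suc n) (suc k)                         ≈⟨ sumA-pascal n k ⟩
    sumA n k + pow q (suc k) * sumA n (suc k)    ≈⟨ +-cong (sumA≈qbinℕ n k) (*-congˡ (sumA≈qbinℕ n (suc k))) ⟩
    qbinℕ q n k + pow q (suc k) * qbinℕ q n (suc k) ∎

theorem1 : ∀ {c ℓ} (R : CommutativeRing c ℓ) (q : CommutativeRing.Carrier R) (n k : ℕ) →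
    let open CommutativeRing R
        open QSeries R
    in (sumRange (ℤ.- (+ k)) (suc (k Data.Nat.+ k))
          (λ j → signPow j * pow q (pentMinus j) * qbin q (+ n) (+ k ℤ.- j) * qbin q (+ n) (+ k ℤ.+ j))
          ≈ qbin q (+ n) (+ k))
     × (sumRange (ℤ.- (+ suc k)) (suc (suc (suc (k Data.Nat.+ k))))
          (λ j → signPow j * pow q (pentMinus j) * qbin q (+ n) (+ k ℤ.- j) * qbin q (+ suc n) (+ k ℤ.+ j))
          ≈ qbin q (+ n) (+ k))
     × (sumRange (ℤ.- (+ suc k)) (suc (suc (suc (k Data.Nat.+ k))))
          (λ j → signPow j * pow q (pentPlus j) * qbin q (+ n) (+ k ℤ.- j) * qbin q (+ suc n) (+ k ℤ.+ j ℤ.+ + 1))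
          ≈ qbin q (+ n) (+ k))
theorem1 R q n k =
  sumA≈qbinℕ n k ,
  trans (reflexive (symSum-length (termB n k))) (trans (sumB≈sumA n k) (sumA≈qbinℕ n k)) ,
  trans (reflexive (symSum-length (termC n k))) (trans (sumC≈sumA n k) (sumA≈qbinℕ n k))
  where
  open CommutativeRing R using (trans; reflexive)
  open QSeries R using (sumRange)
  open PentagonalSums R q
  symSum-length : ∀ f → sumRange (ℤ.- (+ suc k)) (suc (suc (suc (k ℕ.+ k)))) f
                      ≡ sumRange (ℤ.- (+ suc k)) (suc (suc k ℕ.+ suc k)) f
  symSum-length f = ≡.cong (λ len → sumRange (ℤ.- (+ suc k)) (suc (suc len)) f) (≡.sym (ℕ.+-suc k k))
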